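{- Let $h\colon[n]\to[n]$ be a Hessenberg function, $w\in\mathfrak S_n$, and $\widetilde w$ the corresponding generator of $w$. (1) For each associated pattern $p\in\{[2143]_h,[1324]_h,[1243]_h,[2134]_h,[1423]_h,[2314]_h\}$, $w$ contains $p$ if and only if $\widetilde w$ contains $p$. (2) Suppose $w$ avoids the associated pattern $[1324]_h$. Then $w$ contains one of the associated patterns $[25314]_h$, $[24315]_h$, $[14325]_h$, $[15324]_h$ if and only if $\widetilde w$ contains the associated pattern $[25314]_h$.
   Context: A Hessenberg function is a nondecreasing $h\colon[n]\to[n]$ with $h(i)\ge i$. Permutations are in one-line notation. A generator for $h$ is a $v$ with $v^{ -1}(v(i)+1)\le h(i)$ whenever $v(i)\le n-1$. For each $w\in\mathfrak S_n$ there is a unique generator $\widetilde w$ (the corresponding generator of $w$) such that for all $i<j$ with $j\le h(i)$: $\widetilde w(i)<\widetilde w(j)$ iff $w(i)<w(j)$. Associated patterns (for any permutation $w$): $w$ contains $[2143]_h$ if $w(j)<w(i)<w(\ell)<w(k)$ for some $i<j<k<\ell\le h(i)$; $[1324]_h$ if $w(i)<w(k)<w(j)<w(\ell)$ for some $i<j<k<\ell\le h(j)$ with $k\le h(i)$; $[1243]_h$ if $w(i)<w(j)<w(\ell)<w(k)$ for some $i<j<k<\ell\le h(j)$ with $j\le h(i)<\ell$; $[2134]_h$ if $w(j)<w(i)<w(k)<w(\ell)$ for some $i<j<k<\ell\le h(k)$ with $k\le h(i)<\ell$; $[1423]_h$ if $w(i)<w(k)<w(\ell)<w(j)$ for some $i<j<k<\ell\le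 h(j)$ with $k\le h(i)<\ell$; $[2314]_h$ if $w(k)<w(i)<w(j)<w(\ell)$ for some $i<j<k<\ell\le h(j)$ with $k\le h(i)<\ell$. For some $i<j<k\le h(i)<\ell\le h(j)<m\le h(k)$: $[25314]_h$ if $w(\ell)<w(i)<w(k)<w(m)<w(j)$; $[24315]_h$ if $w(\ell)<w(i)<w(k)<w(j)<w(m)$; $[14325]_h$ if $w(i)<w(\ell)<w(k)<w(j)<w(m)$; $[15324]_h$ if $w(i)<w(\ell)<w(k)<w(m)<w(j)$. -}

module Defs where

open import Data.Nat as ℕ using (ℕ; suc)
open import Data.Fin using (Fin; toℕ; _<_; _≤_)
open import Data.Fin.Permutation using (Permutation′; _⟨$⟩ʳ_)
open import Data.Product using (Σ; _×_; ∃; ∃-syntax; _,_)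
open import Data.Sum using (_⊎_)
open import Relation.Binary.PropositionalEquality using (_≡_)
open import Relation.Nullary using (¬_)

-- [n] is modelled as Fin n (0-indexed; order-preserving shift of 1..n).
-- A Hessenberg function: nondecreasing h : [n] → [n] with h(i) ≥ i.
record Hessenberg (n : ℕ) : Set where
  field
    fun  : Fin n → Fin n
    mono : ∀ {i j} → i ≤ j → fun i ≤ fun j
    ext  : ∀ i → i ≤ fun i
open Hessenberg public

Perm : ℕ → Set
Perm n = Permutation′ n

infixl 9 _at_
_at_ : ∀ {n} → Perm n → Fin n → Fin n
w at i = w ⟨$⟩ʳ i

-- v is a generator for h: whenever v(i) ≤ n-1 (i.e. v(i)+1 is a value),
-- v⁻¹(v(i)+1) ≤ h(i).  Phrased as: if v(j) = v(i)+1 then j ≤ h(i).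
IsGenerator : ∀ {n} → Hessenberg n → Perm n → Set
IsGenerator h v = ∀ i j → toℕ (v at j) ≡ suc (toℕ (v at i)) → j ≤ fun h i

SameHRelOrder : ∀ {n} → Hessenberg n → Perm n → Perm n → Set
SameHRelOrder h w v = ∀ i j → i < j → j ≤ fun h i →
  ((w at i < w at j → v at i < v at j) × (v at i < v at j → w at i < w at j))

IsCorrespondingGenerator : ∀ {n} → Hessenberg n → Perm n → Perm n → Set
IsCorrespondingGenerator h w v = IsGenerator h v × SameHRelOrder h w v

module _ {n : ℕ} (h : Hessenberg n) (w : Perm n) where
  private
    H = fun h
    W = _at_ w

  Contains2143 : Set
  Contains2143 = ∃[ i ] ∃[ j ] ∃[ k ] ∃[ l ]
    (i < j × j < k × k < l × l ≤ H i) ×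
    (W j < W i × W i < W l × W l < W k)

  Contains1324 : Set
  Contains1324 = ∃[ i ] ∃[ j ] ∃[ k ] ∃[ l ]
    (i < j × j < k × k < l × l ≤ H j × k ≤ H i) ×
    (W i < W k × W k < W j × W j < W l)

  Contains1243 : Set
  Contains1243 = ∃[ i ] ∃[ j ] ∃[ k ] ∃[ l ]
    (i < j × j < k × k < l × l ≤ H j × j ≤ H i × H i < l) ×
    (W i < W j × W j < W l × W l < W k)

  Contains2134 : Set
  Contains2134 = ∃[ i ] ∃[ j ] ∃[ k ] ∃[ l ]
    (i < j × j < k × k < l × l ≤ H k × k ≤ H i × H i < l) ×
    (W j < W i × W i < W k × W k < W l)

  Contains1423 : Set
  Contains1423 = ∃[ i ] ∃[ j ] ∃[ k ] ∃[ l ]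
    (i < j × j < k × k < l × l ≤ H j × k ≤ H i × H i < l) ×
    (W i < W k × W k < W l × W l < W j)

  Contains2314 : Set
  Contains2314 = ∃[ i ] ∃[ j ] ∃[ k ] ∃[ l ]
    (i < j × j < k × k < l × l ≤ H j × k ≤ H i × H i < l) ×
    (W k < W i × W i < W j × W j < W l)

  Idx5 : Fin n → Fin n → Fin n → Fin n → Fin n → Set
  Idx5 i j k l m = i < j × j < k × k ≤ H i × H i < l × l ≤ H j × H j < m × m ≤ H k

  Contains25314 : Set
  Contains25314 = ∃[ i ] ∃[ j ] ∃[ k ] ∃[ l ] ∃[ m ] Idx5 i j k l m ×
    (W l < W i × W i < W k × W k < W m × W m < W j)

  Contains24315 : Set
  Contains24315 = ∃[ i ] ∃[ j ] ∃[ k ] ∃[ l ] ∃[ m ] Idx5 i j k l m ×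
    (W l < W i × W i < W k × W k < W j × W j < W m)

  Contains14325 : Set
  Contains14325 = ∃[ i ] ∃[ j ] ∃[ k ] ∃[ l ] ∃[ m ] Idx5 i j k l m ×
    (W i < W l × W l < W k × W k < W j × W j < W m)

  Contains15324 : Set
  Contains15324 = ∃[ i ] ∃[ j ] ∃[ k ] ∃[ l ] ∃[ m ] Idx5 i j k l m ×
    (W i < W l × W l < W k × W k < W m × W m < W j)

infix 3 _⇔′_
_⇔′_ : Set → Set → Set
A ⇔′ B = (A → B) × (B → A)

-- Every comparison in the six 4-patterns of (1) is between an h-related pair
-- a < b ≤ h(a), on which w and w̃ agree, so these patterns transfer verbatim.
-- The four 5-patterns of (2) differ only on the unrelated pairs (i,ℓ) and (j,m), so
-- (2) reduces to: a generator avoiding [1324]_h with w̃(i) < w̃(k) < w̃(j) and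
-- w̃(ℓ) < w̃(k) < w̃(m) has w̃(ℓ) < w̃(i) and w̃(m) < w̃(j).  Both follow by walking up
-- the values of w̃ one at a time: the generator condition keeps each step inside the
-- window h of the previous position, and leaving the region forced by the shape
-- produces a [1324]_h.
module Submission where

open import Data.Nat as ℕ using (ℕ; zero; suc; _+_; _∸_)
open import Data.Nat.Properties
  using (<-trans; ≤-trans; <⇒≤; ≤-<-trans; <-≤-trans; <-irrefl; <-asym; <⇒≱;
         ≤-reflexive; ≤-refl; ≰⇒>; ≮⇒≥; m≤m+n; +-identityʳ; +-suc; m+[n∸m]≡n)
open import Data.Fin using (Fin; toℕ; fromℕ<; _<_; _≤_; _<?_; _≤?_)
open import Data.Fin.Properties using (<-cmp; <⇒≢; ≤∧≢⇒<; toℕ-injective; toℕ<n; toℕ-fromℕ<)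
open import Data.Fin.Permutation using (_⟨$⟩ˡ_; inverseʳ)
open import Data.Product using (_×_; _,_; proj₁; proj₂; swap; ∃-syntax)
open import Data.Sum using (_⊎_; inj₁; inj₂)
open import Function using (_∘_)
open import Function.Bundles using (Injection)
open import Function.Properties.Inverse using (↔⇒↣)
open import Relation.Binary using (tri<; tri≈; tri>)
open import Relation.Binary.PropositionalEquality using (_≡_; _≢_; refl; sym; trans; cong; subst)
open import Relation.Nullary using (¬_; yes; no; contradiction)
open import Defs

module _ {n : ℕ} (v : Perm n) where

  at-injective : ∀ {a b} → v at a ≡ v at b → a ≡ b
  at-injective = Injection.injective (↔⇒↣ v)

  at-compare : ∀ {a b} → a ≢ b → v at a < v at b ⊎ v at b < v at a
  at-compare {a} {b} a≢b with <-cmp (v at a) (v at b)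
  ... | tri< va<vb _ _ = inj₁ va<vb
  ... | tri≈ _ va≡vb _ = contradiction (at-injective va≡vb) a≢b
  ... | tri> _ _ vb<va = inj₂ vb<va

  successor⇒< : ∀ {x y} → toℕ (v at x) ≡ suc (toℕ (v at y)) → v at y < v at x
  successor⇒< e = ≤-reflexive (sym e)

  value-induction : (P : Fin n → Set) (a : Fin n) → P a →
    (∀ {y x} → toℕ (v at x) ≡ suc (toℕ (v at y)) → v at a ≤ v at y → P y → P x) →
    ∀ x → v at a ≤ v at x → P x
  value-induction P a base step x a≤x = go (toℕ (v at x) ∸ toℕ (v at a)) x (m+[n∸m]≡n a≤x)
    where
    go : ∀ t x → toℕ (v at a) + t ≡ toℕ (v at x) → P x
    go zero x e = subst P (at-injective (toℕ-injective (trans (sym (+-identityʳ _)) e))) base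
    go (suc t) x e = step x-succ-y (subst (toℕ (v at a) ℕ.≤_) (sym vy≡) (m≤m+n _ t)) (go t y (sym vy≡))
      where
      bound : toℕ (v at a) + t ℕ.< n
      bound = <-trans (≤-reflexive (trans (sym (+-suc _ t)) e)) (toℕ<n (v at x))
      y : Fin n
      y = v ⟨$⟩ˡ fromℕ< bound
      vy≡ : toℕ (v at y) ≡ toℕ (v at a) + t
      vy≡ = trans (cong toℕ (inverseʳ v)) (toℕ-fromℕ< bound)
      x-succ-y : toℕ (v at x) ≡ suc (toℕ (v at y))
      x-succ-y = trans (sym e) (trans (+-suc _ t) (cong suc (sym vy≡)))

module _ {n : ℕ} (h : Hessenberg n) where
  private
    H = fun h
    variable
      a b : Fin n

  H-mono< : a < b → H a ≤ H b
  H-mono< a<b = mono h (<⇒≤ a<b)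

  sameHRelOrder-sym : ∀ {w v} → SameHRelOrder h w v → SameHRelOrder h v w
  sameHRelOrder-sym S a b a<b b≤Ha = swap (S a b a<b b≤Ha)

  -- On an Idx5 tuple these four comparisons fix the order of every h-related pair;
  -- only (i,ℓ) and (j,m) are left free.
  Central : Perm n → (i j k l m : Fin n) → Set
  Central u i j k l m = u at i < u at k × u at k < u at j × u at l < u at k × u at k < u at m

  ContainsCentral : Perm n → Set
  ContainsCentral u = ∃[ i ] ∃[ j ] ∃[ k ] ∃[ l ] ∃[ m ] Idx5 h u i j k l m × Central u i j k l m

  Contains5Pattern : Perm n → Set
  Contains5Pattern u = Contains25314 h u ⊎ Contains24315 h u ⊎ Contains14325 h u ⊎ Contains15324 h u

  module OrderTransfer {w v : Perm n} (S : SameHRelOrder h w v) where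

    ascent-transfer : a < b → b ≤ H a → w at a < w at b → v at a < v at b
    ascent-transfer a<b b≤Ha = proj₁ (S _ _ a<b b≤Ha)

    descent-transfer : a < b → b ≤ H a → w at b < w at a → v at b < v at a
    descent-transfer a<b b≤Ha wb<wa with at-compare v (<⇒≢ a<b)
    ... | inj₁ va<vb = contradiction wb<wa (<-asym (proj₂ (S _ _ a<b b≤Ha) va<vb))
    ... | inj₂ vb<va = vb<va

    private
      up = ascent-transfer
      down = descent-transfer

    contains2143-transfer : Contains2143 h w → Contains2143 h v
    contains2143-transfer (i , j , k , l , idx@(ij , jk , kl , lHi) , (ji , il , lk)) =
      i , j , k , l , idx ,
      (down ij (<⇒≤ (<-≤-trans (<-trans jk kl) lHi)) ji ,
       up (<-trans ij (<-trans jk kl)) lHi il ,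
       down kl (≤-trans lHi (H-mono< (<-trans ij jk))) lk)

    contains1324-transfer : Contains1324 h w → Contains1324 h v
    contains1324-transfer (i , j , k , l , idx@(ij , jk , kl , lHj , kHi) , (ik , kj , jl)) =
      i , j , k , l , idx ,
      (up (<-trans ij jk) kHi ik ,
       down jk (<⇒≤ (<-≤-trans kl lHj)) kj ,
       up (<-trans jk kl) lHj jl)

    contains1243-transfer : Contains1243 h w → Contains1243 h v
    contains1243-transfer (i , j , k , l , idx@(ij , jk , kl , lHj , jHi , _) , (ij′ , jl , lk)) =
      i , j , k , l , idx ,
      (up ij jHi ij′ ,
       up (<-trans jk kl) lHj jl ,
       down kl (≤-trans lHj (H-mono< jk)) lk)

    contains2134-transfer : Contains2134 h w → Contains2134 h v
    contains2134-transfer (i , j , k , l , idx@(ij , jk , kl , lHk , kHi , _) , (ji , ik , kl′)) =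
      i , j , k , l , idx ,
      (down ij (<⇒≤ (<-≤-trans jk kHi)) ji ,
       up (<-trans ij jk) kHi ik ,
       up kl lHk kl′)

    contains1423-transfer : Contains1423 h w → Contains1423 h v
    contains1423-transfer (i , j , k , l , idx@(ij , jk , kl , lHj , kHi , _) , (ik , kl′ , lj)) =
      i , j , k , l , idx ,
      (up (<-trans ij jk) kHi ik ,
       up kl (≤-trans lHj (H-mono< jk)) kl′ ,
       down (<-trans jk kl) lHj lj)

    contains2314-transfer : Contains2314 h w → Contains2314 h v
    contains2314-transfer (i , j , k , l , idx@(ij , jk , kl , lHj , kHi , _) , (ki , ij′ , jl)) =
      i , j , k , l , idx ,
      (down (<-trans ij jk) kHi ki ,
       up ij (<⇒≤ (<-≤-trans jk kHi)) ij′ ,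
       up (<-trans jk kl) lHj jl)

    central-transfer : ContainsCentral w → ContainsCentral v
    central-transfer (i , j , k , l , m , idx@(ij , jk , kHi , Hil , lHj , Hjm , mHk) , (ik , kj , lk , km)) =
      i , j , k , l , m , idx ,
      (up (<-trans ij jk) kHi ik ,
       down jk (≤-trans kHi (H-mono< ij)) kj ,
       down k<l (≤-trans lHj (H-mono< jk)) lk ,
       up (<-trans k<l (≤-<-trans lHj Hjm)) mHk km)
      where
      k<l : k < l
      k<l = ≤-<-trans kHi Hil

  contains5Pattern⇒central : ∀ {u} → Contains5Pattern u → ContainsCentral u
  contains5Pattern⇒central (inj₁ (i , j , k , l , m , idx , (li , ik , km , mj))) =
    i , j , k , l , m , idx , (ik , <-trans km mj , <-trans li ik , km)
  contains5Pattern⇒central (inj₂ (inj₁ (i , j , k , l , m , idx , (li , ik , kj , jm)))) =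
    i , j , k , l , m , idx , (ik , kj , <-trans li ik , <-trans kj jm)
  contains5Pattern⇒central (inj₂ (inj₂ (inj₁ (i , j , k , l , m , idx , (il , lk , kj , jm))))) =
    i , j , k , l , m , idx , (<-trans il lk , kj , lk , <-trans kj jm)
  contains5Pattern⇒central (inj₂ (inj₂ (inj₂ (i , j , k , l , m , idx , (il , lk , km , mj))))) =
    i , j , k , l , m , idx , (<-trans il lk , <-trans km mj , lk , km)

  central⇒contains5Pattern : ∀ {u} → ContainsCentral u → Contains5Pattern u
  central⇒contains5Pattern {u} (i , j , k , l , m , idx@(ij , jk , kHi , Hil , lHj , Hjm , _) , (ik , kj , lk , km))
    with at-compare u (<⇒≢ (≤-<-trans (ext h i) Hil))
       | at-compare u (<⇒≢ (<-trans jk (<-trans (≤-<-trans kHi Hil) (≤-<-trans lHj Hjm))))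
  ... | inj₂ li | inj₂ mj = inj₁ (i , j , k , l , m , idx , (li , ik , km , mj))
  ... | inj₂ li | inj₁ jm = inj₂ (inj₁ (i , j , k , l , m , idx , (li , ik , kj , jm)))
  ... | inj₁ il | inj₁ jm = inj₂ (inj₂ (inj₁ (i , j , k , l , m , idx , (il , lk , kj , jm))))
  ... | inj₁ il | inj₂ mj = inj₂ (inj₂ (inj₂ (i , j , k , l , m , idx , (il , lk , km , mj))))

  module _ {v : Perm n} (generator : IsGenerator h v) (avoid : ¬ Contains1324 h v) where

    high-values-left-of : ∀ {i j k} → i < j → j < k → k ≤ H i →
      v at i < v at k → v at k < v at j → ∀ x → v at j ≤ v at x → x < k
    high-values-left-of {i} {j} {k} ij jk kHi ik kj = value-induction v (_< k) j jk step
      where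
      step : ∀ {y x} → toℕ (v at x) ≡ suc (toℕ (v at y)) → v at j ≤ v at y → y < k → x < k
      step {y} {x} e jy yk with <-cmp x k
      ... | tri< xk _ _ = xk
      ... | tri≈ _ refl _ = contradiction (<-trans kj (≤-<-trans jy (successor⇒< v e))) (<-irrefl refl)
      ... | tri> _ _ kx with i <? y
      ...   | yes iy = contradiction
                (i , y , k , x , (iy , yk , kx , generator y x e , kHi) ,
                 (ik , <-≤-trans kj jy , successor⇒< v e))
                avoid
      ...   | no i≮y = contradiction
                (i , j , k , x ,
                 (ij , jk , kx , ≤-trans (generator y x e) (≤-trans (mono h (≮⇒≥ i≮y)) (H-mono< ij)) , kHi) ,
                 (ik , kj , ≤-<-trans jy (successor⇒< v e)))
                avoid

    value-band-within-window : ∀ {i k l m} → i < k → k ≤ H i → H i < l → l < m → m ≤ H k →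
      v at l < v at k → v at k < v at m → ∀ x → v at i ≤ v at x → v at x ≤ v at l → x ≤ H i
    value-band-within-window {i} {k} {l} {m} ik kHi Hil lm mHk lk km =
      value-induction v (λ x → v at x ≤ v at l → x ≤ H i) i (λ _ → ext h i) step
      where
      step : ∀ {y x} → toℕ (v at x) ≡ suc (toℕ (v at y)) → v at i ≤ v at y →
             (v at y ≤ v at l → y ≤ H i) → v at x ≤ v at l → x ≤ H i
      step {y} {x} e iy window-y xl with x ≤? H i
      ... | yes xHi = xHi
      ... | no x≰Hi = contradiction (≰⇒> x≰Hi) escape
        where
        yx : v at y < v at x
        yx = successor⇒< v e
        xk : v at x < v at k
        xk = ≤-<-trans xl lk
        yHi : y ≤ H i
        yHi = window-y (<⇒≤ (<-≤-trans yx xl))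
        escape : ¬ H i < x
        escape Hix with <-cmp y k
        ... | tri≈ _ refl _ = <-irrefl refl (<-trans yx xk)
        ... | tri> _ _ ky = avoid
                (i , k , y , m , (ik , ky , ≤-<-trans yHi (<-trans Hil lm) , mHk , yHi) ,
                 (≤∧≢⇒< iy (<⇒≢ (<-trans ik ky) ∘ at-injective v) , <-trans yx xk , km))
        ... | tri< yk _ _ with x <? m
        ...   | yes xm = avoid
                  (y , k , x , m , (yk , ≤-<-trans kHi Hix , xm , mHk , generator y x e) , (yx , xk , km))
        ...   | no x≮m = avoid
                  (y , k , l , m ,
                   (yk , ≤-<-trans kHi Hil , lm , mHk , <⇒≤ (<-≤-trans lm (≤-trans (≮⇒≥ x≮m) (generator y x e)))) ,
                   (<-≤-trans yx xl , lk , km))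

    central⇒contains25314 : ContainsCentral v → Contains25314 h v
    central⇒contains25314 (i , j , k , l , m , idx@(ij , jk , kHi , Hil , lHj , Hjm , mHk) , (ik , kj , lk , km)) =
      i , j , k , l , m , idx , (li , ik , km , mj)
      where
      li : v at l < v at i
      li with v at i ≤? v at l
      ... | yes il = contradiction
              (value-band-within-window (<-trans ij jk) kHi Hil (≤-<-trans lHj Hjm) mHk lk km l il ≤-refl)
              (<⇒≱ Hil)
      ... | no i≰l = ≰⇒> i≰l
      mj : v at m < v at j
      mj with v at j ≤? v at m
      ... | yes jm = contradiction
              (high-values-left-of ij jk kHi ik kj m jm)
              (<-asym (<-trans (≤-<-trans kHi Hil) (≤-<-trans lHj Hjm)))
      ... | no j≰m = ≰⇒> j≰m

lemma4p13 : (n : ℕ) (h : Hessenberg n) (w w̃ : Perm n) →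
    IsCorrespondingGenerator h w w̃ →
    ((Contains2143 h w ⇔′ Contains2143 h w̃) ×
     (Contains1324 h w ⇔′ Contains1324 h w̃) ×
     (Contains1243 h w ⇔′ Contains1243 h w̃) ×
     (Contains2134 h w ⇔′ Contains2134 h w̃) ×
     (Contains1423 h w ⇔′ Contains1423 h w̃) ×
     (Contains2314 h w ⇔′ Contains2314 h w̃)) ×
    (¬ Contains1324 h w →
      ((Contains25314 h w ⊎ Contains24315 h w ⊎ Contains14325 h w ⊎ Contains15324 h w)
        ⇔′ Contains25314 h w̃))
lemma4p13 n h w w̃ (generator , S) =
  ((⇒.contains2143-transfer , ⇐.contains2143-transfer) ,
   (⇒.contains1324-transfer , ⇐.contains1324-transfer) ,
   (⇒.contains1243-transfer , ⇐.contains1243-transfer) ,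
   (⇒.contains2134-transfer , ⇐.contains2134-transfer) ,
   (⇒.contains1423-transfer , ⇐.contains1423-transfer) ,
   (⇒.contains2314-transfer , ⇐.contains2314-transfer)) ,
  λ w-avoids →
    (central⇒contains25314 h {w̃} generator (w-avoids ∘ ⇐.contains1324-transfer)
       ∘ ⇒.central-transfer ∘ contains5Pattern⇒central h {w}) ,
    (central⇒contains5Pattern h {w} ∘ ⇐.central-transfer ∘ contains5Pattern⇒central h {w̃} ∘ inj₁)
  where
  module ⇒ = OrderTransfer h {w} {w̃} S
  module ⇐ = OrderTransfer h {w̃} {w} (sameHRelOrder-sym h {w} {w̃} S)
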